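{- Let $\lambda\ge1$, $\delta\ge1$ and $\gamma\ge1$ be integers, and let $K(a,c)=\gamma(2+a+c)^\lambda$. For all nonnegative integers $a,b,c$, the following are equivalent: (i) there exist nonnegative integers $h_1,\dots,h_\delta$ with $c\ge\max\{h_1,\dots,h_\delta\}$ and $b=\sum_{\iota=1}^{\delta}h_\iota\,(K(a,c))^{(\lambda+1)^\iota}$; (ii) all of the following hold: (a) there exists a nonnegative integer $d$ with $b=d\,(K(a,c))^{\lambda+1}$; (b) for each $\iota=1,\dots,\delta-1$ there exist nonnegative integers $d,e$ with $b=d\,(K(a,c))^{(\lambda+1)^{\iota+1}}+e$ and $e<(c+1)(K(a,c))^{(\lambda+1)^\iota}$; (c) $b<(c+1)(K(a,c))^{(\lambda+1)^\delta}$. -}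

module Defs where

open import Data.Nat using (ℕ; zero; suc; _+_; _*_; _^_)
open import Data.Fin using (Fin; toℕ)
import Data.Fin as F

K : (λ' γ a c : ℕ) → ℕ
K λ' γ a c = γ * (2 + a + c) ^ λ'

sumFin : (n : ℕ) → (Fin n → ℕ) → ℕ
sumFin zero    f = 0
sumFin (suc n) f = f F.zero + sumFin n (λ i → f (F.suc i))

module Submission where

-- The theorem is the mixed-radix digit criterion for the weights
-- R ι = K^((λ+1)^ι).
--
-- This only needs two properties of the weights: R ι ∣ R (ι+1) and
-- (c+1) R ι ≤ R (ι+1).  Forward, the part of the sum above position m is a
-- multiple of R (m+1), while the part below is < (c+1) R m.  Backward, the
-- digits are read off as h_ι = (b mod R (ι+1)) / R ι, and by induction the
-- partial sums of these digits are the remainders b mod R (ι+1).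

open import Defs
open import Data.Nat using (ℕ; zero; suc; _+_; _*_; _^_; _≤_; _<_; _∸_; z≤n; s≤s;
  NonZero; >-nonZero; _%_; _/_)
open import Data.Nat.Properties
open import Data.Nat.DivMod using (m≡m%n+[m/n]*n; [m+kn]%n≡m%n; m*n%n≡0; m%n≤m;
  m<n⇒m%n≡m; m∣n⇒o%n%m≡o%m; m<n*o⇒m/o<n)
open import Data.Nat.Divisibility using (_∣_; divides; ∣-refl; ∣-trans; m∣m*n)
open import Data.Fin using (Fin; toℕ)
import Data.Fin as F
open import Data.Fin.Properties using (toℕ<n)
open import Data.Product using (_×_; ∃-syntax; Σ-syntax; _,_; map₁)
open import Data.Sum using (inj₁; inj₂)
open import Function.Bundles using (_⇔_; mk⇔)
open import Function.Properties.Equivalence using () renaming (trans to ⇔-trans)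
open import Relation.Binary.PropositionalEquality
open import Data.Nat.Tactic.RingSolver using (solve-∀)

psum : (ℕ → ℕ) → ℕ → ℕ
psum f zero    = 0
psum f (suc n) = psum f n + f n

psum-peel : ∀ (f : ℕ → ℕ) n → psum f (suc n) ≡ f 0 + psum (λ j → f (suc j)) n
psum-peel f zero    = +-comm 0 (f 0)
psum-peel f (suc n) = begin
  psum f (suc n) + f (suc n)                  ≡⟨ cong (_+ f (suc n)) (psum-peel f n) ⟩
  f 0 + psum (λ j → f (suc j)) n + f (suc n)  ≡⟨ +-assoc (f 0) _ (f (suc n)) ⟩
  f 0 + psum (λ j → f (suc j)) (suc n)        ∎
  where open ≡-Reasoning

sumFin-toℕ : ∀ n (f : ℕ → ℕ) → sumFin n (λ i → f (toℕ i)) ≡ psum f n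
sumFin-toℕ zero    f = refl
sumFin-toℕ (suc n) f =
  trans (cong (f 0 +_) (sumFin-toℕ n (λ j → f (suc j)))) (sym (psum-peel f n))

sumFin-cong : ∀ n {f g : Fin n → ℕ} → (∀ i → f i ≡ g i) → sumFin n f ≡ sumFin n g
sumFin-cong zero    f≗g = refl
sumFin-cong (suc n) f≗g = cong₂ _+_ (f≗g F.zero) (sumFin-cong n (λ i → f≗g (F.suc i)))

extend : ∀ {n} → (Fin n → ℕ) → ℕ → ℕ
extend {zero}  h j       = 0
extend {suc n} h zero    = h F.zero
extend {suc n} h (suc j) = extend (λ i → h (F.suc i)) j

extend-toℕ : ∀ {n} (h : Fin n → ℕ) (i : Fin n) → extend h (toℕ i) ≡ h i
extend-toℕ h F.zero    = refl
extend-toℕ h (F.suc i) = extend-toℕ (λ i → h (F.suc i)) i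

extend-≤ : ∀ {n} {c} (h : Fin n → ℕ) → (∀ i → h i ≤ c) → ∀ j → extend h j ≤ c
extend-≤ {zero}  h h≤c j       = z≤n
extend-≤ {suc n} h h≤c zero    = h≤c F.zero
extend-≤ {suc n} h h≤c (suc j) = extend-≤ (λ i → h (F.suc i)) (λ i → h≤c (F.suc i)) j

suc*-split : ∀ c x → (c + 1) * x ≡ x + c * x
suc*-split c x = cong (_* x) (+-comm c 1)

-- Positional notation for a weight sequence R with R ι ∣ R (ι+1) and
-- (c+1) R ι ≤ R (ι+1); digit j (counted from 0) has weight R (j+1).
module Positional (R : ℕ → ℕ) (c : ℕ) {{R≢0 : ∀ {ι} → NonZero (R ι)}}
                  (R-∣ : ∀ ι → R ι ∣ R (suc ι))
                  (R-grows : ∀ ι → (c + 1) * R ι ≤ R (suc ι)) where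

  value : (ℕ → ℕ) → ℕ → ℕ
  value g = psum (λ j → g j * R (suc j))

  R-∣-+ : ∀ ι k → R ι ∣ R (ι + k)
  R-∣-+ ι zero    = subst (R ι ∣_) (cong R (sym (+-identityʳ ι))) ∣-refl
  R-∣-+ ι (suc k) = subst (R ι ∣_) (cong R (sym (+-suc ι k)))
                          (∣-trans (R-∣-+ ι k) (R-∣ (ι + k)))

  value-split : ∀ g m k → ∃[ d ] (value g (m + k) ≡ d * R (suc m) + value g m)
  value-split g m zero    = 0 , cong (value g) (+-identityʳ m)
  value-split g m (suc k) with value-split g m k | R-∣-+ (suc m) k
  ... | d , split | divides t R≡ = d + g (m + k) * t , (begin
    value g (m + suc k)                                   ≡⟨ cong (value g) (+-suc m k) ⟩
    value g (m + k) + g (m + k) * R (suc (m + k))         ≡⟨ cong₂ (λ x y → x + g (m + k) * y) split R≡ ⟩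
    d * R (suc m) + value g m + g (m + k) * (t * R (suc m)) ≡⟨ regroup d (value g m) (g (m + k)) t (R (suc m)) ⟩
    (d + g (m + k) * t) * R (suc m) + value g m           ∎)
    where
    open ≡-Reasoning
    regroup : ∀ d v x t r → d * r + v + x * (t * r) ≡ (d + x * t) * r + v
    regroup = solve-∀

  value-bound : ∀ g → (∀ j → g j ≤ c) → ∀ m → value g m < (c + 1) * R m
  value-bound g g≤c zero    = *-monoˡ-< (R 0) (m≤n+m 1 c)
  value-bound g g≤c (suc m) = begin-strict
    value g m + g m * R (suc m)     <⟨ +-mono-<-≤ (value-bound g g≤c m) (*-monoˡ-≤ (R (suc m)) (g≤c m)) ⟩
    (c + 1) * R m + c * R (suc m)   ≤⟨ +-monoˡ-≤ (c * R (suc m)) (R-grows m) ⟩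
    R (suc m) + c * R (suc m)       ≡⟨ sym (suc*-split c (R (suc m))) ⟩
    (c + 1) * R (suc m)             ∎
    where open ≤-Reasoning

  digit : ℕ → ℕ → ℕ
  digit b j = (b % R (suc (suc j))) / R (suc j)

  remainder-expansion : ∀ b → ∃[ d ] (b ≡ d * R 1) → ∀ m → b % R (suc m) ≡ value (digit b) m
  remainder-expansion b (d , b≡) zero = trans (cong (_% R 1) b≡) (m*n%n≡0 d (R 1))
  remainder-expansion b R₁∣b (suc j) = begin
    b % R (suc (suc j))                               ≡⟨ m≡m%n+[m/n]*n (b % R (suc (suc j))) (R (suc j)) ⟩
    b % R (suc (suc j)) % R (suc j) + digit b j * R (suc j)
      ≡⟨ cong (_+ digit b j * R (suc j)) (m∣n⇒o%n%m≡o%m (R (suc j)) (R (suc (suc j))) b (R-∣ (suc j))) ⟩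
    b % R (suc j) + digit b j * R (suc j)             ≡⟨ cong (_+ digit b j * R (suc j)) (remainder-expansion b R₁∣b j) ⟩
    value (digit b) j + digit b j * R (suc j)         ∎
    where open ≡-Reasoning

  digit-bound : ∀ b j → b % R (suc (suc j)) < (c + 1) * R (suc j) → digit b j ≤ c
  digit-bound b j small = m<1+n⇒m≤n (subst (digit b j <_) (+-comm c 1) (m<n*o⇒m/o<n small))

  remainder-of : ∀ {b d e} ι → b ≡ d * R (suc ι) + e → e < (c + 1) * R ι → b % R (suc ι) ≡ e
  remainder-of {b} {d} {e} ι b≡ e< = begin
    b % R (suc ι)                ≡⟨ cong (_% R (suc ι)) (trans b≡ (+-comm (d * R (suc ι)) e)) ⟩
    (e + d * R (suc ι)) % R (suc ι) ≡⟨ [m+kn]%n≡m%n e d (R (suc ι)) ⟩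
    e % R (suc ι)                ≡⟨ m<n⇒m%n≡m (<-≤-trans e< (R-grows ι)) ⟩
    e                            ∎
    where open ≡-Reasoning

  Representable : ℕ → ℕ → Set
  Representable n b = Σ[ h ∈ (Fin n → ℕ) ] ((∀ i → h i ≤ c) ×
                      (b ≡ sumFin n (λ i → h i * R (suc (toℕ i)))))

  Criterion : ℕ → ℕ → Set
  Criterion n b = (∃[ d ] (b ≡ d * R 1)) ×
                  (∀ ι → 1 ≤ ι → ι < n →
                     ∃[ d ] ∃[ e ] ((b ≡ d * R (ι + 1) + e) × (e < (c + 1) * R ι))) ×
                  (b < (c + 1) * R n)

  representable⇒criterion : ∀ n b → Representable n b → Criterion n b
  representable⇒criterion n b (h , h≤c , b≡sum) = divisible , remainders , bounded
    where
    g : ℕ → ℕ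
    g = extend h

    b≡value : b ≡ value g n
    b≡value = begin
      b                                                 ≡⟨ b≡sum ⟩
      sumFin n (λ i → h i * R (suc (toℕ i)))
        ≡⟨ sumFin-cong n (λ i → cong (_* R (suc (toℕ i))) (sym (extend-toℕ h i))) ⟩
      sumFin n (λ i → g (toℕ i) * R (suc (toℕ i)))      ≡⟨ sumFin-toℕ n (λ j → g j * R (suc j)) ⟩
      value g n                                         ∎
      where open ≡-Reasoning

    divisible : ∃[ d ] (b ≡ d * R 1)
    divisible with value-split g 0 n
    ... | d , split = d , trans b≡value (trans split (+-identityʳ (d * R 1)))

    remainders : ∀ ι → 1 ≤ ι → ι < n →
                 ∃[ d ] ∃[ e ] ((b ≡ d * R (ι + 1) + e) × (e < (c + 1) * R ι))
    remainders ι _ ι<n with value-split g ι (n ∸ ι)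
    ... | d , split = d , value g ι , b≡ , value-bound g (extend-≤ h h≤c) ι
      where
      open ≡-Reasoning
      b≡ : b ≡ d * R (ι + 1) + value g ι
      b≡ = begin
        b                              ≡⟨ b≡value ⟩
        value g n                      ≡⟨ cong (value g) (sym (m+[n∸m]≡n (<⇒≤ ι<n))) ⟩
        value g (ι + (n ∸ ι))          ≡⟨ split ⟩
        d * R (suc ι) + value g ι      ≡⟨ cong (λ k → d * R k + value g ι) (+-comm 1 ι) ⟩
        d * R (ι + 1) + value g ι      ∎

    bounded : b < (c + 1) * R n
    bounded = subst (_< (c + 1) * R n) (sym b≡value) (value-bound g (extend-≤ h h≤c) n)

  criterion⇒representable : ∀ n b → Criterion n b → Representable n b
  criterion⇒representable n b (R₁∣b , remainders , b<) =
    (λ i → digit b (toℕ i)) ,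
    (λ i → digit-bound b (toℕ i) (small-remainder (toℕ i) (toℕ<n i))) ,
    b≡digits
    where
    b%top : b % R (suc n) ≡ b
    b%top = m<n⇒m%n≡m (<-≤-trans b< (R-grows n))

    -- Below the top position the bound comes from (b), at the top from (c).
    small-remainder : ∀ j → suc j ≤ n → b % R (suc (suc j)) < (c + 1) * R (suc j)
    small-remainder j j<n with m≤n⇒m<n∨m≡n j<n
    ... | inj₂ refl = ≤-<-trans (m%n≤m b (R (suc n))) b<
    ... | inj₁ sj<n with remainders (suc j) (s≤s z≤n) sj<n
    ...   | d , e , b≡ , e< = subst (_< (c + 1) * R (suc j)) (sym b%≡e) e<
      where
      b%≡e : b % R (suc (suc j)) ≡ e
      b%≡e = remainder-of {d = d} (suc j)
               (trans b≡ (cong (λ k → d * R k + e) (+-comm (suc j) 1))) e<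

    b≡digits : b ≡ sumFin n (λ i → digit b (toℕ i) * R (suc (toℕ i)))
    b≡digits = begin
      b                                       ≡⟨ sym b%top ⟩
      b % R (suc n)                           ≡⟨ remainder-expansion b R₁∣b n ⟩
      value (digit b) n                       ≡⟨ sym (sumFin-toℕ n (λ j → digit b j * R (suc j))) ⟩
      sumFin n (λ i → digit b (toℕ i) * R (suc (toℕ i))) ∎
      where open ≡-Reasoning

  representable⇔criterion : ∀ n b → Representable n b ⇔ Criterion n b
  representable⇔criterion n b = mk⇔ (representable⇒criterion n b) (criterion⇒representable n b)

base≤power : ∀ x .{{_ : NonZero x}} e → 1 ≤ e → x ≤ x ^ e
base≤power x e 1≤e = ≤-trans (≤-reflexive (sym (*-identityʳ x))) (^-monoʳ-≤ x 1≤e)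

-- The weights K^(ρ^ι) for ρ = r+1 ≥ 2: each level is the (r+1)-st power of
-- the previous one, hence divides the next and is exceeded by a factor ≥ K.
module Tower (K r : ℕ) {{K≢0 : NonZero K}} (1≤r : 1 ≤ r) where

  level : ℕ → ℕ
  level ι = K ^ (suc r ^ ι)

  level≢0 : ∀ ι → NonZero (level ι)
  level≢0 ι = m^n≢0 K (suc r ^ ι)

  level-suc : ∀ ι → level (suc ι) ≡ level ι * level ι ^ r
  level-suc ι = trans (cong (K ^_) (*-comm (suc r) (suc r ^ ι)))
                      (sym (^-*-assoc K (suc r ^ ι) (suc r)))

  level-∣ : ∀ ι → level ι ∣ level (suc ι)
  level-∣ ι = subst (level ι ∣_) (sym (level-suc ι)) (m∣m*n (level ι ^ r))

  K≤level : ∀ ι → K ≤ level ι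
  K≤level ι = base≤power K (suc r ^ ι) (m^n>0 (suc r) ι)

  level-grows : ∀ {m} → m ≤ K → ∀ ι → m * level ι ≤ level (suc ι)
  level-grows {m} m≤K ι = begin
    m * level ι               ≤⟨ *-monoˡ-≤ (level ι) m≤level^r ⟩
    level ι ^ r * level ι     ≡⟨ *-comm (level ι ^ r) (level ι) ⟩
    level ι * level ι ^ r     ≡⟨ sym (level-suc ι) ⟩
    level (suc ι)             ∎
    where
    open ≤-Reasoning
    m≤level^r : m ≤ level ι ^ r
    m≤level^r = ≤-trans m≤K (≤-trans (K≤level ι) (base≤power (level ι) {{level≢0 ι}} r 1≤r))

K-large : ∀ λ' γ a c → 1 ≤ λ' → 1 ≤ γ → c + 1 ≤ K λ' γ a c
K-large λ' γ a c 1≤λ' 1≤γ = begin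
  c + 1                ≡⟨ +-comm c 1 ⟩
  suc c                ≤⟨ s≤s (≤-trans (m≤n+m c a) (n≤1+n (a + c))) ⟩
  2 + a + c            ≤⟨ base≤power (2 + a + c) λ' 1≤λ' ⟩
  (2 + a + c) ^ λ'     ≤⟨ m≤n*m _ γ {{>-nonZero 1≤γ}} ⟩
  γ * (2 + a + c) ^ λ' ∎
  where open ≤-Reasoning

lemma2 : (λ' δ γ : ℕ) → 1 ≤ λ' → 1 ≤ δ → 1 ≤ γ → (a b c : ℕ) →
    (Σ[ h ∈ (Fin δ → ℕ) ] ((∀ (i : Fin δ) → h i ≤ c) ×
             (b ≡ sumFin δ (λ i → h i * K λ' γ a c ^ ((λ' + 1) ^ suc (toℕ i))))))
    ⇔
    ((∃[ d ] (b ≡ d * K λ' γ a c ^ (λ' + 1))) ×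
     (∀ (ι : ℕ) → 1 ≤ ι → ι < δ →
        ∃[ d ] ∃[ e ] ((b ≡ d * K λ' γ a c ^ ((λ' + 1) ^ (ι + 1)) + e) ×
                       (e < (c + 1) * K λ' γ a c ^ ((λ' + 1) ^ ι)))) ×
     (b < (c + 1) * K λ' γ a c ^ ((λ' + 1) ^ δ)))
lemma2 λ'@(suc l) δ γ 1≤λ' _ 1≤γ a b c =
  ⇔-trans (representable⇔criterion δ b)
          (mk⇔ (map₁ (subst MultipleOf level₁)) (map₁ (subst MultipleOf (sym level₁))))
  where
  c+1≤K : c + 1 ≤ K λ' γ a c
  c+1≤K = K-large λ' γ a c 1≤λ' 1≤γ

  instance
    K≢0 : NonZero (K λ' γ a c)
    K≢0 = >-nonZero (≤-trans (m≤n+m 1 c) c+1≤K)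

  -- λ' + 1 reduces to suc (l + 1), so the weights are the tower levels with r = l + 1.
  open Tower (K λ' γ a c) (l + 1) (m≤n+m 1 l)
  open Positional level c {{λ {ι} → level≢0 ι}} level-∣ (level-grows c+1≤K)

  MultipleOf : ℕ → Set
  MultipleOf x = ∃[ d ] (b ≡ d * x)

  -- Clause (a) of the statement writes the first weight K^((λ+1)^1) as K^(λ+1).
  level₁ : level 1 ≡ K λ' γ a c ^ (λ' + 1)
  level₁ = cong (K λ' γ a c ^_) (*-identityʳ (λ' + 1))
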